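{- For every PCoR* term $t$ over $\Sigma$ and every graph $G \in \mathcal{G}(t)$, the treewidth of $G$ is at most $2$.
   Context: PCoR* terms over $\Sigma$: $t ::= a \mid 1 \mid 0 \mid \top \mid t;t \mid t+t \mid t\cap t \mid t^{\smile} \mid t^{*}$, $a\in\Sigma$. A graph (with one source and one target) over $\Sigma$ is a tuple $G=(|G|,(a^G)_{a\in\Sigma},\mathrm{src}^G,\mathrm{tgt}^G)$ with $|G|$ a set, $a^G\subseteq|G|^2$, and $\mathrm{src}^G,\mathrm{tgt}^G\in|G|$; graphs are identified up to isomorphism (bijections preserving and reflecting all relations and preserving source and target). Series composition $G;H$: disjoint union of $G$ and $H$ with $\mathrm{tgt}^G$ identified with $\mathrm{src}^H$, source $\mathrm{src}^G$, target $\mathrm{tgt}^H$. Parallel composition $G\parallel H$: disjoint union with the two sources identified and the two targets identified. The graph language $\mathcal G(t)$: $\mathcal G(a)$ = the single graph with two vertices $u\neq v$, $a^G=\{(u,v)\}$, all other relations empty, source $u$, target $v$; $\mathcal G(1)$ = the single one-vertex graph with no edges whose source and target coincide; $\mathcal G(0)=\emptyset$; $\mathcal G(\top)$ = the single graph with two distinct vertices, no edges, source one and target the other; $\mathcal G(t^{\smile})=\{G$ with source and target swapped $: G\in\mathcal G(t)\}$; $\mathcal G(t\cap s)=\{G\parallel H: G\in\mathcal G(t),H\in\mathcal G(s)\}$; $\mathcal G(t;s)=\{G;H: G\in\mathcal G(t),H\in\mathcal G(s)\}$; $\mathcal G(t+s)=\mathcal G(t)\cup\mathcal G(s)$; $\mathcal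 G(t^{*})=\bigcup_{n\ge0}\mathcal G(t^n)$ where $t^0=1$ and $t^{n}=t;t^{n-1}$. The treewidth of a graph $G$ is the treewidth of the undirected simple graph on $|G|$ with an edge between distinct $x,y$ whenever $(x,y)\in a^G$ for some $a$ (source and target are ignored). -}

module Defs where

open import Data.Nat using (ℕ; zero; suc; _≤_)
open import Data.Fin using (Fin; zero; suc; toℕ; inject₁)
open import Data.Sum using (_⊎_; inj₁; inj₂)
open import Data.Product using (Σ; ∃; ∃-syntax; _×_; _,_)
open import Data.Empty using (⊥)
open import Data.List using (List; length)
open import Data.List.Membership.Propositional using (_∈_)
open import Relation.Nullary using (¬_)
open import Relation.Binary.PropositionalEquality using (_≡_; _≢_)
open import Relation.Binary.Construct.Closure.Equivalence using (EqClosure)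
open import Function.Bundles using (_⇔_)

data Term (Σ : Set) : Set where
  atom  : Σ → Term Σ
  one   : Term Σ
  zer   : Term Σ
  top   : Term Σ
  _⨾_   : Term Σ → Term Σ → Term Σ
  _⊕_   : Term Σ → Term Σ → Term Σ
  _⊓_   : Term Σ → Term Σ → Term Σ
  _˘    : Term Σ → Term Σ
  _⋆    : Term Σ → Term Σ

pow : {Σ : Set} → Term Σ → ℕ → Term Σ
pow t zero    = one
pow t (suc n) = t ⨾ pow t n

-- Graphs with one source and one target; vertex sets are Fin n
-- (all graphs in a language G(t) are finite).  Graphs are compared
-- up to isomorphism (see _≅_).

record Graph (Σ : Set) : Set₁ where
  field
    size : ℕ
    rel  : Σ → Fin size → Fin size → Set
    src  : Fin size
    tgt  : Fin size
open Graph public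

record _≅_ {Σ : Set} (G H : Graph Σ) : Set where
  field
    to      : Fin (size G) → Fin (size H)
    from    : Fin (size H) → Fin (size G)
    from∘to : ∀ x → from (to x) ≡ x
    to∘from : ∀ y → to (from y) ≡ y
    rel-iff : ∀ a x y → rel G a x y ⇔ rel H a (to x) (to y)
    src-pres : to (src G) ≡ src H
    tgt-pres : to (tgt G) ≡ tgt H

atomGraph : {Σ : Set} → Σ → Graph Σ
atomGraph {Σ} a = record
  { size = 2 ; rel = λ b x y → (b ≡ a) × (x ≡ zero) × (y ≡ suc zero)
  ; src = zero ; tgt = suc zero }

oneGraph : {Σ : Set} → Graph Σ
oneGraph = record { size = 1 ; rel = λ _ _ _ → ⊥ ; src = zero ; tgt = zero }

topGraph : {Σ : Set} → Graph Σ
topGraph = record { size = 2 ; rel = λ _ _ _ → ⊥ ; src = zero ; tgt = suc zero }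

converse : {Σ : Set} → Graph Σ → Graph Σ
converse G = record { size = size G ; rel = rel G ; src = tgt G ; tgt = src G }

unionRel : {Σ : Set} (G H : Graph Σ) → Σ →
           Fin (size G) ⊎ Fin (size H) → Fin (size G) ⊎ Fin (size H) → Set
unionRel G H a (inj₁ x) (inj₁ y) = rel G a x y
unionRel G H a (inj₂ x) (inj₂ y) = rel H a x y
unionRel G H a (inj₁ _) (inj₂ _) = ⊥
unionRel G H a (inj₂ _) (inj₁ _) = ⊥

-- K is (a representative of) the disjoint union of G and H quotiented by
-- the equivalence relation generated by R: q is the surjective quotient
-- map whose kernel is exactly EqClosure R, and the relations of K are the
-- images of those of the disjoint union.
record IsGluing {Σ : Set} (G H : Graph Σ)
       (R : Fin (size G) ⊎ Fin (size H) → Fin (size G) ⊎ Fin (size H) → Set)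
       (K : Graph Σ) : Set where
  field
    q      : Fin (size G) ⊎ Fin (size H) → Fin (size K)
    q-surj : ∀ z → ∃[ p ] q p ≡ z
    q-ker  : ∀ p p' → (q p ≡ q p') ⇔ EqClosure R p p'
    q-rel  : ∀ a z z' → rel K a z z' ⇔
               (∃[ p ] ∃[ p' ] (q p ≡ z × q p' ≡ z' × unionRel G H a p p'))

SeqId : {Σ : Set} (G H : Graph Σ) →
        Fin (size G) ⊎ Fin (size H) → Fin (size G) ⊎ Fin (size H) → Set
SeqId G H p p' = (p ≡ inj₁ (tgt G)) × (p' ≡ inj₂ (src H))

ParId : {Σ : Set} (G H : Graph Σ) →
        Fin (size G) ⊎ Fin (size H) → Fin (size G) ⊎ Fin (size H) → Set
ParId G H p p' = ((p ≡ inj₁ (src G)) × (p' ≡ inj₂ (src H)))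
               ⊎ ((p ≡ inj₁ (tgt G)) × (p' ≡ inj₂ (tgt H)))

IsSeries : {Σ : Set} → Graph Σ → Graph Σ → Graph Σ → Set
IsSeries G H K = Σ (IsGluing G H (SeqId G H) K) λ gl →
  (IsGluing.q gl (inj₁ (src G)) ≡ src K) × (IsGluing.q gl (inj₂ (tgt H)) ≡ tgt K)

IsParallel : {Σ : Set} → Graph Σ → Graph Σ → Graph Σ → Set
IsParallel G H K = Σ (IsGluing G H (ParId G H) K) λ gl →
  (IsGluing.q gl (inj₁ (src G)) ≡ src K) × (IsGluing.q gl (inj₁ (tgt G)) ≡ tgt K)

data _∈𝒢_ {Σ : Set} : Graph Σ → Term Σ → Set₁ where
  g-atom : ∀ {K a} → K ≅ atomGraph a → K ∈𝒢 atom a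
  g-one  : ∀ {K} → K ≅ oneGraph → K ∈𝒢 one
  g-top  : ∀ {K} → K ≅ topGraph → K ∈𝒢 top
  g-conv : ∀ {K G t} → G ∈𝒢 t → K ≅ converse G → K ∈𝒢 (t ˘)
  g-cap  : ∀ {K G H t s} → G ∈𝒢 t → H ∈𝒢 s → IsParallel G H K → K ∈𝒢 (t ⊓ s)
  g-seq  : ∀ {K G H t s} → G ∈𝒢 t → H ∈𝒢 s → IsSeries G H K → K ∈𝒢 (t ⨾ s)
  g-inl  : ∀ {K t s} → K ∈𝒢 t → K ∈𝒢 (t ⊕ s)
  g-inr  : ∀ {K t s} → K ∈𝒢 s → K ∈𝒢 (t ⊕ s)
  g-star : ∀ {K t} n → K ∈𝒢 pow t n → K ∈𝒢 (t ⋆)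
  -- no constructor for zer: G(0) = ∅

-- Finite trees on nodes Fin (suc m), given by parent pointers:
-- node (suc i) has parent (parent i), a node with smaller index.
-- Every finite nonempty tree arises this way.

record Tree : Set where
  field
    m      : ℕ
    parent : Fin m → Fin (suc m)
    parent< : ∀ i → toℕ (parent i) ≤ toℕ i
open Tree public

Node : Tree → Set
Node T = Fin (suc (m T))

TAdj : (T : Tree) → Node T → Node T → Set
TAdj T x y = ∃[ i ] ((x ≡ suc i × y ≡ parent T i) ⊎ (y ≡ suc i × x ≡ parent T i))

data WalkIn (T : Tree) (P : Node T → Set) : Node T → Node T → Set where
  here : ∀ {x} → P x → WalkIn T P x x
  step : ∀ {x y z} → P x → TAdj T x y → WalkIn T P y z → WalkIn T P x z

UAdj : {Σ : Set} (G : Graph Σ) → Fin (size G) → Fin (size G) → Set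
UAdj {Σ} G x y = x ≢ y × ∃[ a ] (rel G a x y ⊎ rel G a y x)

record TreeDecomp {Σ : Set} (G : Graph Σ) (k : ℕ) : Set where
  field
    tree       : Tree
    bag        : Node tree → List (Fin (size G))
    bag-size   : ∀ i → length (bag i) ≤ suc k
    vertex-cov : ∀ v → ∃[ i ] v ∈ bag i
    edge-cov   : ∀ x y → UAdj G x y → ∃[ i ] (x ∈ bag i × y ∈ bag i)
    connected  : ∀ v i j → v ∈ bag i → v ∈ bag j →
                 WalkIn tree (λ l → v ∈ bag l) i j

TreewidthAtMost : {Σ : Set} → Graph Σ → ℕ → Set
TreewidthAtMost G k = TreeDecomp G k

{-# OPTIONS --safe #-}
module Submission where

-- Every graph of 𝒢(t) has a tree decomposition of width 2 whose root bag contains its source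
-- and target; we build it by induction on the derivation of G ∈𝒢 t.  Atoms, 1 and ⊤ have at most
-- three vertices, so a single bag suffices; converse swaps the two roles and isomorphic copies
-- inherit the decomposition.  For G ; H and G ∥ H, the decompositions of G and H are hung below a
-- new root bag holding the at most three glued interface vertices.  Gluing identifies only
-- interface vertices, and these lie in the old root bags, so every vertex shared between the two
-- parts, or between a part and the new root, is connected through the new root.  Sums and stars
-- add nothing, as 𝒢(t*) is the union of the 𝒢(tⁿ).

open import Defs
open import Data.Nat using (ℕ; zero; suc; _≤_; _+_; z≤n; s≤s)
open import Data.Nat.Properties using (+-suc; +-monoʳ-≤; module ≤-Reasoning)
open import Data.Fin using (Fin; zero; suc; toℕ; _↑ˡ_; _↑ʳ_; splitAt)
open import Data.Fin.Properties using (splitAt-↑ˡ; splitAt-↑ʳ; join-splitAt; toℕ-↑ˡ; toℕ-↑ʳ)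
open import Data.Sum using (_⊎_; inj₁; inj₂; [_,_]′)
open import Data.Product using (Σ; ∃; ∃-syntax; _×_; _,_; proj₁; proj₂; uncurry)
open import Data.List using (List; []; _∷_; length; map; allFin)
open import Data.List.Properties using (length-map; length-tabulate)
open import Data.List.Membership.Propositional using (_∈_)
open import Data.List.Relation.Unary.Any using (here; there)
open import Data.List.Membership.Propositional.Properties using (∈-map⁺; ∈-map⁻; ∈-allFin)
open import Relation.Binary.PropositionalEquality using (_≡_; _≢_; refl; sym; trans; cong; subst)
open import Relation.Binary.Construct.Closure.Symmetric using (fwd; bwd)
open import Relation.Binary.Construct.Closure.ReflexiveTransitive using (ε; _◅_)
open import Function.Base using (_∘_; id)
open import Function.Bundles using (Equivalence)

module _ {T : Tree} where

  TAdj-sym : ∀ {x y} → TAdj T x y → TAdj T y x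
  TAdj-sym (i , inj₁ e) = i , inj₂ e
  TAdj-sym (i , inj₂ e) = i , inj₁ e

  module _ {P : Node T → Set} where

    walk-head : ∀ {x y} → WalkIn T P x y → P x
    walk-head (here p)     = p
    walk-head (step p _ _) = p

    _++ʷ_ : ∀ {x y z} → WalkIn T P x y → WalkIn T P y z → WalkIn T P x z
    here _     ++ʷ w′ = w′
    step p a w ++ʷ w′ = step p a (w ++ʷ w′)

    reverseʷ : ∀ {x y} → WalkIn T P x y → WalkIn T P y x
    reverseʷ (here p)     = here p
    reverseʷ (step p a w) = reverseʷ w ++ʷ step (walk-head w) (TAdj-sym a) (here p)

mapʷ : ∀ {T T′ P P′} (f : Node T → Node T′) →
       (∀ {x y} → TAdj T x y → TAdj T′ (f x) (f y)) → (∀ {x} → P x → P′ (f x)) →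
       ∀ {x y} → WalkIn T P x y → WalkIn T′ P′ (f x) (f y)
mapʷ f f-adj f-P (here p)     = here (f-P p)
mapʷ f f-adj f-P (step p a w) = step (f-P p) (f-adj a) (mapʷ f f-adj f-P w)

data Side : Set where
  left right : Side

module Join (T : Side → Tree) where

  private
    n : Side → ℕ
    n s = suc (m (T s))

    Inner : Set
    Inner = Fin (n left + n right)

    base : Side → ℕ
    base left  = 0
    base right = n left

    offset : ∀ s → Node (T s) → Inner
    offset left  i = i ↑ˡ n right
    offset right i = n left ↑ʳ i

    toℕ-offset : ∀ s i → toℕ (offset s i) ≡ base s + toℕ i
    toℕ-offset left  i = toℕ-↑ˡ i (n right)
    toℕ-offset right i = toℕ-↑ʳ (n left) i

    side-of : Inner → Σ Side (λ s → Node (T s))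
    side-of k = [ (left ,_) , (right ,_) ]′ (splitAt (n left) k)

    side-of-offset : ∀ s i → side-of (offset s i) ≡ (s , i)
    side-of-offset left  i rewrite splitAt-↑ˡ (n left) i (n right) = refl
    side-of-offset right i rewrite splitAt-↑ʳ (n left) (n right) i = refl

    offset-side-of : ∀ k → uncurry offset (side-of k) ≡ k
    offset-side-of k with splitAt (n left) k | join-splitAt (n left) (n right) k
    ... | inj₁ i | refl = refl
    ... | inj₂ i | refl = refl

  embed : ∀ s → Node (T s) → Fin (suc (n left + n right))
  embed s i = suc (offset s i)

  private
    parent-in : ∀ s → Node (T s) → Fin (suc (n left + n right))
    parent-in s zero    = zero
    parent-in s (suc i) = embed s (parent (T s) i)

    parent-in≤ : ∀ s i → toℕ (parent-in s i) ≤ toℕ (offset s i)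
    parent-in≤ s zero    = z≤n
    parent-in≤ s (suc i) = begin
      suc (toℕ (offset s (parent (T s) i))) ≡⟨ cong suc (toℕ-offset s (parent (T s) i)) ⟩
      suc (base s + toℕ (parent (T s) i))   ≡⟨ sym (+-suc (base s) _) ⟩
      base s + suc (toℕ (parent (T s) i))   ≤⟨ +-monoʳ-≤ (base s) (s≤s (parent< (T s) i)) ⟩
      base s + toℕ (suc i)                  ≡⟨ sym (toℕ-offset s (suc i)) ⟩
      toℕ (offset s (suc i))                ∎
      where open ≤-Reasoning

    joinParent : Inner → Fin (suc (n left + n right))
    joinParent k = uncurry parent-in (side-of k)

    joinParent≤ : ∀ k → toℕ (joinParent k) ≤ toℕ k
    joinParent≤ k with side-of k | offset-side-of k
    ... | s , i | refl = parent-in≤ s i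

    joinParent-offset : ∀ s i → joinParent (offset s i) ≡ parent-in s i
    joinParent-offset s i = cong (uncurry parent-in) (side-of-offset s i)

  joinTree : Tree
  joinTree = record { m = n left + n right ; parent = joinParent ; parent< = joinParent≤ }

  embed-adj : ∀ s {x y} → TAdj (T s) x y → TAdj joinTree (embed s x) (embed s y)
  embed-adj s (i , inj₁ (refl , refl)) =
    offset s (suc i) , inj₁ (refl , sym (joinParent-offset s (suc i)))
  embed-adj s (i , inj₂ (refl , refl)) =
    offset s (suc i) , inj₂ (refl , sym (joinParent-offset s (suc i)))

  embed-root-adj : ∀ s → TAdj joinTree (embed s zero) zero
  embed-root-adj s = offset s zero , inj₁ (refl , sym (joinParent-offset s zero))

  data NodeView : Node joinTree → Set where
    root  : NodeView zero
    inner : ∀ s i → NodeView (embed s i)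

  nodeView : ∀ l → NodeView l
  nodeView zero = root
  nodeView (suc k) with side-of k | offset-side-of k
  ... | s , i | refl = inner s i

  joinBags : {A : Set} → List A → (∀ s → Node (T s) → List A) → Node joinTree → List A
  joinBags r b zero    = r
  joinBags r b (suc k) = uncurry b (side-of k)

  joinBags-embed : {A : Set} (r : List A) (b : ∀ s → Node (T s) → List A) →
                   ∀ s i → joinBags r b (embed s i) ≡ b s i
  joinBags-embed r b s i = cong (uncurry b) (side-of-offset s i)

record RootedDecomp {Σ : Set} (G : Graph Σ) (k : ℕ) : Set where
  field
    decomp   : TreeDecomp G k
    src∈root : src G ∈ TreeDecomp.bag decomp zero
    tgt∈root : tgt G ∈ TreeDecomp.bag decomp zero
  open TreeDecomp decomp public

module _ {Σ : Set} {k : ℕ} where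

  singleBag : (G : Graph Σ) → size G ≤ suc k → RootedDecomp G k
  singleBag G small = record
    { decomp = record
      { tree       = record { m = 0 ; parent = λ () ; parent< = λ () }
      ; bag        = λ _ → allFin (size G)
      ; bag-size   = λ _ → subst (_≤ suc k) (sym (length-tabulate (λ i → i))) small
      ; vertex-cov = λ v → zero , ∈-allFin v
      ; edge-cov   = λ x y _ → zero , ∈-allFin x , ∈-allFin y
      ; connected  = λ { v zero zero h _ → here h } }
    ; src∈root = ∈-allFin (src G)
    ; tgt∈root = ∈-allFin (tgt G) }

  converseDecomp : {G : Graph Σ} → RootedDecomp G k → RootedDecomp (converse G) k
  converseDecomp D = record
    { decomp = record
      { tree = tree ; bag = bag ; bag-size = bag-size ; vertex-cov = vertex-cov
      ; edge-cov = edge-cov ; connected = connected }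
    ; src∈root = tgt∈root
    ; tgt∈root = src∈root }
    where open RootedDecomp D

  module _ {K G : Graph Σ} (iso : K ≅ G) where
    open _≅_ iso

    ∈-pullback : ∀ {v xs} → to v ∈ xs → v ∈ map from xs
    ∈-pullback {v} h = subst (_∈ map from _) (from∘to v) (∈-map⁺ from h)

    ∈-pullback⁻ : ∀ {v xs} → v ∈ map from xs → to v ∈ xs
    ∈-pullback⁻ h with ∈-map⁻ from h
    ... | w , hw , refl = subst (_∈ _) (sym (to∘from w)) hw

    UAdj-to : ∀ {x y} → UAdj K x y → UAdj G (to x) (to y)
    UAdj-to {x} {y} (x≢y , a , r) = to-injective x≢y , a , rel-to r
      where
        to-injective : x ≢ y → to x ≢ to y
        to-injective x≢y e = x≢y (trans (sym (from∘to x)) (trans (cong from e) (from∘to y)))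
        rel-to : rel K a x y ⊎ rel K a y x → rel G a (to x) (to y) ⊎ rel G a (to y) (to x)
        rel-to (inj₁ r) = inj₁ (Equivalence.to (rel-iff a x y) r)
        rel-to (inj₂ r) = inj₂ (Equivalence.to (rel-iff a y x) r)

    pullbackDecomp : RootedDecomp G k → RootedDecomp K k
    pullbackDecomp D = record
      { decomp = record
        { tree       = tree
        ; bag        = λ i → map from (bag i)
        ; bag-size   = λ i → subst (_≤ suc k) (sym (length-map from (bag i))) (bag-size i)
        ; vertex-cov = λ v → let (i , h) = vertex-cov (to v) in i , ∈-pullback h
        ; edge-cov   = λ x y xy → let (i , hx , hy) = edge-cov (to x) (to y) (UAdj-to xy)
                                  in i , ∈-pullback hx , ∈-pullback hy
        ; connected  = λ v i j hi hj →
            mapʷ id id ∈-pullback (connected (to v) i j (∈-pullback⁻ hi) (∈-pullback⁻ hj)) }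
      ; src∈root = ∈-pullback (subst (_∈ bag zero) (sym src-pres) src∈root)
      ; tgt∈root = ∈-pullback (subst (_∈ bag zero) (sym tgt-pres) tgt∈root) }
      where open RootedDecomp D

IsTerminal : {Σ : Set} (G : Graph Σ) → Fin (size G) → Set
IsTerminal G x = x ≡ src G ⊎ x ≡ tgt G

terminal∈root : ∀ {Σ k} {G : Graph Σ} (D : RootedDecomp G k) {x} →
                IsTerminal G x → x ∈ RootedDecomp.bag D zero
terminal∈root D (inj₁ refl) = RootedDecomp.src∈root D
terminal∈root D (inj₂ refl) = RootedDecomp.tgt∈root D

related⇒identified : ∀ {Σ} {G H K : Graph Σ} {R} (gl : IsGluing G H R K) {p p′} →
                     R p p′ → IsGluing.q gl p ≡ IsGluing.q gl p′
related⇒identified gl r = Equivalence.from (IsGluing.q-ker gl _ _) (fwd r ◅ ε)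

Interface : {Σ : Set} (G H : Graph Σ) → Fin (size G) ⊎ Fin (size H) → Set
Interface G H (inj₁ x) = IsTerminal G x
Interface G H (inj₂ y) = IsTerminal H y

module Gluing {Σ : Set} {k : ℕ} {G H K : Graph Σ} (D : RootedDecomp G k) (E : RootedDecomp H k)
  {R : Fin (size G) ⊎ Fin (size H) → Fin (size G) ⊎ Fin (size H) → Set}
  (gl : IsGluing G H R K)
  (rootBag : List (Fin (size K))) (rootBag-size : length rootBag ≤ suc k)
  (R⇒Interface : ∀ {p p′} → R p p′ → Interface G H p × Interface G H p′)
  (Interface⇒∈rootBag : ∀ {p} → Interface G H p → IsGluing.q gl p ∈ rootBag)
  (∈rootBag⇒Interface : ∀ {v} → v ∈ rootBag → ∃[ p ] (Interface G H p × IsGluing.q gl p ≡ v))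
  where

  open IsGluing gl

  private
    part : Side → Graph Σ
    part left  = G
    part right = H

    ι : ∀ s → Fin (size (part s)) → Fin (size G) ⊎ Fin (size H)
    ι left  = inj₁
    ι right = inj₂

    ι-injective : ∀ s s′ {x x′} → ι s x ≡ ι s′ x′ →
                  _≡_ {A = ∃ λ s → Fin (size (part s))} (s , x) (s′ , x′)
    ι-injective left  left  refl = refl
    ι-injective right right refl = refl
    ι-injective left  right ()
    ι-injective right left  ()

    decOf : ∀ s → RootedDecomp (part s) k
    decOf left  = D
    decOf right = E

    module Decomp (s : Side) = RootedDecomp (decOf s)

    interface∈root : ∀ s {x} → Interface G H (ι s x) → x ∈ Decomp.bag s zero
    interface∈root left  = terminal∈root D
    interface∈root right = terminal∈root E

  open Join (λ s → Decomp.tree s)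

  partBag : ∀ s → Node (Decomp.tree s) → List (Fin (size K))
  partBag s i = map (q ∘ ι s) (Decomp.bag s i)

  gluedBag : Node joinTree → List (Fin (size K))
  gluedBag = joinBags rootBag partBag

  gluedBag-embed : ∀ s i → gluedBag (embed s i) ≡ partBag s i
  gluedBag-embed = joinBags-embed rootBag partBag

  -- A non-trivial chain of identifications starts with an R-step, and R only relates interface points.
  identified⇒≡⊎Interface : ∀ {p p′} → q p ≡ q p′ → p ≡ p′ ⊎ Interface G H p
  identified⇒≡⊎Interface {p} {p′} e with Equivalence.to (q-ker p p′) e
  ... | ε         = inj₁ refl
  ... | fwd r ◅ _ = inj₂ (proj₁ (R⇒Interface r))
  ... | bwd r ◅ _ = inj₂ (proj₂ (R⇒Interface r))

  q∈rootBag⇒Interface : ∀ {p} → q p ∈ rootBag → Interface G H p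
  q∈rootBag⇒Interface h with ∈rootBag⇒Interface h
  ... | p′ , ip′ , e with identified⇒≡⊎Interface (sym e)
  ...   | inj₁ refl = ip′
  ...   | inj₂ ip   = ip

  ∈-gluedBag⁺ : ∀ s {i x} → x ∈ Decomp.bag s i → q (ι s x) ∈ gluedBag (embed s i)
  ∈-gluedBag⁺ s {i} h = subst (_ ∈_) (sym (gluedBag-embed s i)) (∈-map⁺ (q ∘ ι s) h)

  ∈-gluedBag⁻ : ∀ s {i v} → v ∈ gluedBag (embed s i) →
                ∃[ x ] (x ∈ Decomp.bag s i × q (ι s x) ≡ v)
  ∈-gluedBag⁻ s {i} {v} h with ∈-map⁻ (q ∘ ι s) (subst (v ∈_) (gluedBag-embed s i) h)
  ... | x , hx , refl = x , hx , refl

  liftʷ : ∀ s {x i j} → WalkIn (Decomp.tree s) (λ l → x ∈ Decomp.bag s l) i j →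
          WalkIn joinTree (λ l → q (ι s x) ∈ gluedBag l) (embed s i) (embed s j)
  liftʷ s = mapʷ (embed s) (embed-adj s) (∈-gluedBag⁺ s)

  walkToRoot : ∀ {v} l → v ∈ gluedBag l → v ∈ rootBag →
               WalkIn joinTree (λ l → v ∈ gluedBag l) l zero
  walkToRoot l h r with nodeView l
  ... | root = here h
  ... | inner s i with ∈-gluedBag⁻ s h
  ...   | x , hx , refl =
    liftʷ s (Decomp.connected s x i zero hx x∈root) ++ʷ
    step (∈-gluedBag⁺ s x∈root) (embed-root-adj s) (here r)
    where x∈root = interface∈root s (q∈rootBag⇒Interface r)

  walkViaRoot : ∀ {v} l l′ → v ∈ gluedBag l → v ∈ gluedBag l′ → v ∈ rootBag →
                WalkIn joinTree (λ l → v ∈ gluedBag l) l l′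
  walkViaRoot l l′ h h′ r = walkToRoot l h r ++ʷ reverseʷ (walkToRoot l′ h′ r)

  connected : ∀ v l l′ → v ∈ gluedBag l → v ∈ gluedBag l′ →
              WalkIn joinTree (λ l → v ∈ gluedBag l) l l′
  connected v l l′ h h′ with nodeView l | nodeView l′
  ... | root      | _     = walkViaRoot l l′ h h′ h
  ... | inner _ _ | root  = walkViaRoot l l′ h h′ h′
  ... | inner s i | inner s′ i′ with ∈-gluedBag⁻ s h | ∈-gluedBag⁻ s′ h′
  ...   | x , hx , refl | x′ , hx′ , e with identified⇒≡⊎Interface (sym e)
  ...     | inj₂ ip = walkViaRoot l l′ h h′ (Interface⇒∈rootBag ip)
  ...     | inj₁ ιx≡ιx′ with ι-injective s s′ ιx≡ιx′
  ...       | refl = liftʷ s (Decomp.connected s x i i′ hx hx′)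

  gluedBag-size : ∀ l → length (gluedBag l) ≤ suc k
  gluedBag-size l with nodeView l
  ... | root      = rootBag-size
  ... | inner s i
    rewrite gluedBag-embed s i | length-map (q ∘ ι s) (Decomp.bag s i) =
      Decomp.bag-size s i

  vertex-cov-part : ∀ s x → ∃[ l ] q (ι s x) ∈ gluedBag l
  vertex-cov-part s x = let (i , h) = Decomp.vertex-cov s x in embed s i , ∈-gluedBag⁺ s h

  vertex-cov : ∀ v → ∃[ l ] v ∈ gluedBag l
  vertex-cov v with q-surj v
  ... | inj₁ x , refl = vertex-cov-part left x
  ... | inj₂ y , refl = vertex-cov-part right y

  edge-cov-part : ∀ s x x′ → q (ι s x) ≢ q (ι s x′) →
                  ∃[ a ] (rel (part s) a x x′ ⊎ rel (part s) a x′ x) →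
                  ∃[ l ] (q (ι s x) ∈ gluedBag l × q (ι s x′) ∈ gluedBag l)
  edge-cov-part s x x′ qx≢qx′ (a , r) with Decomp.edge-cov s x x′ (qx≢qx′ ∘ cong (q ∘ ι s) , a , r)
  ... | i , hx , hx′ = embed s i , ∈-gluedBag⁺ s hx , ∈-gluedBag⁺ s hx′

  edge-cov-union : ∀ p p′ → q p ≢ q p′ → ∃[ a ] (unionRel G H a p p′ ⊎ unionRel G H a p′ p) →
                   ∃[ l ] (q p ∈ gluedBag l × q p′ ∈ gluedBag l)
  edge-cov-union (inj₁ x) (inj₁ x′) = edge-cov-part left x x′
  edge-cov-union (inj₂ y) (inj₂ y′) = edge-cov-part right y y′
  edge-cov-union (inj₁ _) (inj₂ _) _ (_ , inj₁ ())
  edge-cov-union (inj₁ _) (inj₂ _) _ (_ , inj₂ ())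
  edge-cov-union (inj₂ _) (inj₁ _) _ (_ , inj₁ ())
  edge-cov-union (inj₂ _) (inj₁ _) _ (_ , inj₂ ())

  edge-cov : ∀ v w → UAdj K v w → ∃[ l ] (v ∈ gluedBag l × w ∈ gluedBag l)
  edge-cov v w (v≢w , a , inj₁ r) with Equivalence.to (q-rel a v w) r
  ... | p , p′ , refl , refl , u = edge-cov-union p p′ v≢w (a , inj₁ u)
  edge-cov v w (v≢w , a , inj₂ r) with Equivalence.to (q-rel a w v) r
  ... | p′ , p , refl , refl , u = edge-cov-union p p′ v≢w (a , inj₂ u)

  glued : TreeDecomp K k
  glued = record
    { tree = joinTree ; bag = gluedBag ; bag-size = gluedBag-size
    ; vertex-cov = vertex-cov ; edge-cov = edge-cov ; connected = connected }

seriesDecomp : ∀ {Σ k} {G H K : Graph Σ} → 2 ≤ k → IsSeries G H K →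
               RootedDecomp G k → RootedDecomp H k → RootedDecomp K k
seriesDecomp {G = G} {H} 2≤k (gl , q-src , q-tgt) D E = record
  { decomp   = Gluing.glued D E gl rootBag (s≤s 2≤k)
                 R⇒Interface Interface⇒∈rootBag ∈rootBag⇒Interface
  ; src∈root = subst (_∈ rootBag) q-src (here refl)
  ; tgt∈root = subst (_∈ rootBag) q-tgt (there (there (here refl))) }
  where
    open IsGluing gl
    rootBag = q (inj₁ (src G)) ∷ q (inj₁ (tgt G)) ∷ q (inj₂ (tgt H)) ∷ []
    R⇒Interface : ∀ {p p′} → SeqId G H p p′ → Interface G H p × Interface G H p′
    R⇒Interface (refl , refl) = inj₂ refl , inj₁ refl
    Interface⇒∈rootBag : ∀ {p} → Interface G H p → q p ∈ rootBag
    Interface⇒∈rootBag {inj₁ _} (inj₁ refl) = here refl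
    Interface⇒∈rootBag {inj₁ _} (inj₂ refl) = there (here refl)
    Interface⇒∈rootBag {inj₂ _} (inj₁ refl) = there (here (sym (related⇒identified gl (refl , refl))))
    Interface⇒∈rootBag {inj₂ _} (inj₂ refl) = there (there (here refl))
    ∈rootBag⇒Interface : ∀ {v} → v ∈ rootBag → ∃[ p ] (Interface G H p × q p ≡ v)
    ∈rootBag⇒Interface (here refl)                 = inj₁ (src G) , inj₁ refl , refl
    ∈rootBag⇒Interface (there (here refl))         = inj₁ (tgt G) , inj₂ refl , refl
    ∈rootBag⇒Interface (there (there (here refl))) = inj₂ (tgt H) , inj₂ refl , refl

parallelDecomp : ∀ {Σ k} {G H K : Graph Σ} → 1 ≤ k → IsParallel G H K →
                 RootedDecomp G k → RootedDecomp H k → RootedDecomp K k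
parallelDecomp {G = G} {H} 1≤k (gl , q-src , q-tgt) D E = record
  { decomp   = Gluing.glued D E gl rootBag (s≤s 1≤k)
                 R⇒Interface Interface⇒∈rootBag ∈rootBag⇒Interface
  ; src∈root = subst (_∈ rootBag) q-src (here refl)
  ; tgt∈root = subst (_∈ rootBag) q-tgt (there (here refl)) }
  where
    open IsGluing gl
    rootBag = q (inj₁ (src G)) ∷ q (inj₁ (tgt G)) ∷ []
    R⇒Interface : ∀ {p p′} → ParId G H p p′ → Interface G H p × Interface G H p′
    R⇒Interface (inj₁ (refl , refl)) = inj₁ refl , inj₁ refl
    R⇒Interface (inj₂ (refl , refl)) = inj₂ refl , inj₂ refl
    Interface⇒∈rootBag : ∀ {p} → Interface G H p → q p ∈ rootBag
    Interface⇒∈rootBag {inj₁ _} (inj₁ refl) = here refl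
    Interface⇒∈rootBag {inj₁ _} (inj₂ refl) = there (here refl)
    Interface⇒∈rootBag {inj₂ _} (inj₁ refl) = here (sym (related⇒identified gl (inj₁ (refl , refl))))
    Interface⇒∈rootBag {inj₂ _} (inj₂ refl) = there (here (sym (related⇒identified gl (inj₂ (refl , refl)))))
    ∈rootBag⇒Interface : ∀ {v} → v ∈ rootBag → ∃[ p ] (Interface G H p × q p ≡ v)
    ∈rootBag⇒Interface (here refl)         = inj₁ (src G) , inj₁ refl , refl
    ∈rootBag⇒Interface (there (here refl)) = inj₁ (tgt G) , inj₂ refl , refl

rootedDecomp : ∀ {Σ} {t : Term Σ} {K : Graph Σ} → K ∈𝒢 t → RootedDecomp K 2
rootedDecomp (g-atom {a = a} K≅) = pullbackDecomp K≅ (singleBag (atomGraph a) (s≤s (s≤s z≤n)))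
rootedDecomp (g-one K≅)          = pullbackDecomp K≅ (singleBag oneGraph (s≤s z≤n))
rootedDecomp (g-top K≅)          = pullbackDecomp K≅ (singleBag topGraph (s≤s (s≤s z≤n)))
rootedDecomp (g-conv G∈ K≅)      = pullbackDecomp K≅ (converseDecomp (rootedDecomp G∈))
rootedDecomp (g-cap G∈ H∈ K=G∥H) =
  parallelDecomp (s≤s z≤n) K=G∥H (rootedDecomp G∈) (rootedDecomp H∈)
rootedDecomp (g-seq G∈ H∈ K=G⨾H) =
  seriesDecomp (s≤s (s≤s z≤n)) K=G⨾H (rootedDecomp G∈) (rootedDecomp H∈)
rootedDecomp (g-inl K∈)          = rootedDecomp K∈
rootedDecomp (g-inr K∈)          = rootedDecomp K∈
rootedDecomp (g-star n K∈)       = rootedDecomp K∈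

proposition2p5 : {Σ : Set} (t : Term Σ) (G : Graph Σ) → G ∈𝒢 t → TreewidthAtMost G 2
proposition2p5 t G G∈ = RootedDecomp.decomp (rootedDecomp G∈)
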